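{- Every Lie ring satisfying the chain condition on centralizers ($\mathfrak{M}_c$) is $\mathfrak{Z}_f$: for every iterated center $Z_i(L)$, the center of $L/Z_i(L)$ equals the centralizer in $L/Z_i(L)$ of some finite set of elements.
   Context: $C_L(X)=\{y\in L:[y,x]=0\ \forall x\in X\}$; $L$ is $\mathfrak{M}_c$ if there is no infinite strictly descending and no infinite strictly ascending chain of centralizers. Iterated centers: $Z_0(L)=0$ and $Z_{i+1}(L)$ is the preimage in $L$ of the center of $L/Z_i(L)$. -}

module Defs where

open import Level using (Level; _⊔_; suc; Lift)
open import Data.Nat using (ℕ; zero) renaming (suc to nsuc)
open import Data.Fin using (Fin)
open import Data.Product using (Σ; ∃; _×_; _,_)
open import Data.Unit.Polymorphic using (⊤)
open import Relation.Nullary using (¬_)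
open import Relation.Binary.Core using (Rel)
open import Algebra.Core using (Op₁; Op₂)
open import Algebra.Structures using (IsAbelianGroup)

record LieRing (c ℓ : Level) : Set (suc (c ⊔ ℓ)) where
  infixl 6 _+_
  infix 4 _≈_
  field
    Carrier : Set c
    _≈_     : Rel Carrier ℓ
    _+_     : Op₂ Carrier
    0#      : Carrier
    -_      : Op₁ Carrier
    [_,_]   : Op₂ Carrier
    isAbelianGroup : IsAbelianGroup _≈_ _+_ 0# -_
    bracket-cong : ∀ {x x′ y y′} → x ≈ x′ → y ≈ y′ → [ x , y ] ≈ [ x′ , y′ ]
    bracket-distribˡ : ∀ x y z → [ x , y + z ] ≈ [ x , y ] + [ x , z ]
    bracket-distribʳ : ∀ x y z → [ x + y , z ] ≈ [ x , z ] + [ y , z ]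
    alternating : ∀ x → [ x , x ] ≈ 0#
    jacobi : ∀ x y z → [ x , [ y , z ] ] + [ y , [ z , x ] ] + [ z , [ x , y ] ] ≈ 0#

  open IsAbelianGroup isAbelianGroup public

module LieRingTheory {c ℓ : Level} (L : LieRing c ℓ) where
  open LieRing L

  Subset : Set (suc (c ⊔ ℓ))
  Subset = Carrier → Set (c ⊔ ℓ)

  _⊆_ : Subset → Subset → Set (c ⊔ ℓ)
  A ⊆ B = ∀ y → A y → B y

  _≐_ : Subset → Subset → Set (c ⊔ ℓ)
  A ≐ B = (A ⊆ B) × (B ⊆ A)

  _⊂_ : Subset → Subset → Set (c ⊔ ℓ)
  A ⊂ B = (A ⊆ B) × ∃ λ y → B y × ¬ A y

  -- Centralizer modulo a subset I:  { y | [y,x] ∈ I for all x ∈ X }.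
  -- For I an ideal this is the preimage in L of the centralizer of X+I/I
  -- in L/I.
  CentMod : Subset → Subset → Subset
  CentMod I X y = ∀ x → X x → I [ y , x ]

  Zero : Subset
  Zero y = Lift c (y ≈ 0#)

  C : Subset → Subset
  C X = CentMod Zero X

  Everything : Subset
  Everything _ = ⊤

  -- Iterated centers: Z_0 = 0, Z_{i+1} = preimage of Z(L/Z_i).
  Z : ℕ → Subset
  Z zero     = Zero
  Z (nsuc i) = CentMod (Z i) Everything

  FinSet : ∀ {n} → (Fin n → Carrier) → Subset
  FinSet {n} a x = Lift c (∃ λ (j : Fin n) → x ≈ a j)

  Mc : Set (suc (c ⊔ ℓ))
  Mc = (¬ ∃ λ (X : ℕ → Subset) → ∀ n → C (X (nsuc n)) ⊂ C (X n))
     × (¬ ∃ λ (X : ℕ → Subset) → ∀ n → C (X n) ⊂ C (X (nsuc n)))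

  -- 𝔛_f: for every i, Z(L/Z_i) is the centralizer in L/Z_i of a finite
  -- set (stated via preimages in L).
  Zf : Set (c ⊔ ℓ)
  Zf = ∀ (i : ℕ) → ∃ λ (n : ℕ) → ∃ λ (a : Fin n → Carrier) →
         Z (nsuc i) ≐ CentMod (Z i) (FinSet a)

{-# OPTIONS --safe #-}
-- Modulo Z i that condition is
-- lost, so one proves by induction on i, for all k at once, that the centralizer modulo Z i of a
-- family of commutators of weight k + 1 is cut out by a finite subfamily together with finitely
-- many elements centralized modulo the deeper Z (k + i). The case k = 0 for the family of all
-- elements is the theorem; the step i → i + 1 passes to heavier commutators using the Jacobi
-- identity and the fact that [Z (k + j + 1) , c] ⊆ Z j for every commutator c of weight k + 1.
module Submission where

open import Level using (Level; _⊔_; Lift; lift)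
open import Axiom.ExcludedMiddle using (ExcludedMiddle)
open import Axiom.DoubleNegationElimination using (DoubleNegationElimination; em⇒dne)
open import Function using (id)
open import Data.Nat using (ℕ; zero; suc) renaming (_+_ to _+ℕ_)
open import Data.Nat.Properties using (+-suc)
open import Data.Product using (∃; ∃-syntax; _×_; _,_; proj₁)
open import Data.Unit.Polymorphic using (⊤; tt)
open import Data.List using (List; []; _∷_; _++_; map; length; lookup)
open import Data.List.Relation.Unary.All as All using (All)
open import Data.List.Relation.Unary.All.Properties using (++⁻ˡ; ++⁻ʳ; map⁺; map⁻)
open import Data.List.Relation.Unary.Any using (here; there; index)
open import Data.List.Relation.Unary.Any.Properties using (lookup-index)
open import Data.List.Membership.Propositional using (_∈_)
open import Relation.Nullary using (¬_)
open import Relation.Binary.PropositionalEquality as ≡ using (subst)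
open import Algebra.Bundles using (Group)
import Algebra.Properties.Group as GroupProperties
import Relation.Binary.Reasoning.Setoid as SetoidReasoning
open import Defs

module LieRingProperties {c ℓ : Level} (L : LieRing c ℓ) where
  open LieRing L
  open LieRingTheory L

  +-group : Group c ℓ
  +-group = record { isGroup = isGroup }

  open GroupProperties +-group
    using (identityˡ-unique; inverseʳ-unique; ⁻¹-involutive; ε⁻¹≈ε; //-rightDividesʳ)
  open SetoidReasoning setoid

  bracket-zeroˡ : ∀ y → [ 0# , y ] ≈ 0#
  bracket-zeroˡ y = identityˡ-unique [ 0# , y ] [ 0# , y ] (begin
    [ 0# , y ] + [ 0# , y ]  ≈⟨ bracket-distribʳ 0# 0# y ⟨
    [ 0# + 0# , y ]          ≈⟨ bracket-cong (identityˡ 0#) refl ⟩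
    [ 0# , y ]               ∎)

  bracket-anticomm : ∀ x y → [ y , x ] ≈ - [ x , y ]
  bracket-anticomm x y = inverseʳ-unique [ x , y ] [ y , x ] (begin
    [ x , y ] + [ y , x ]                              ≈⟨ ∙-cong (identityˡ _) (identityʳ _) ⟨
    (0# + [ x , y ]) + ([ y , x ] + 0#)                ≈⟨ ∙-cong (∙-congʳ (alternating x)) (∙-congˡ (alternating y)) ⟨
    ([ x , x ] + [ x , y ]) + ([ y , x ] + [ y , y ])  ≈⟨ ∙-cong (bracket-distribˡ x x y) (bracket-distribˡ y x y) ⟨
    [ x , x + y ] + [ y , x + y ]                      ≈⟨ bracket-distribʳ x y (x + y) ⟨
    [ x + y , x + y ]                                  ≈⟨ alternating (x + y) ⟩
    0#                                                 ∎)

  bracket-negˡ : ∀ x y → [ - x , y ] ≈ - [ x , y ]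
  bracket-negˡ x y = inverseʳ-unique [ x , y ] [ - x , y ] (begin
    [ x , y ] + [ - x , y ]  ≈⟨ bracket-distribʳ x (- x) y ⟨
    [ x + - x , y ]          ≈⟨ bracket-cong (inverseʳ x) refl ⟩
    [ 0# , y ]               ≈⟨ bracket-zeroˡ y ⟩
    0#                       ∎)

  bracket-leibnizʳ : ∀ g y a → [ [ g , y ] , a ] ≈ [ g , [ y , a ] ] + [ [ g , a ] , y ]
  bracket-leibnizʳ g y a = begin
    [ [ g , y ] , a ]                      ≈⟨ bracket-anticomm a [ g , y ] ⟩
    - [ a , [ g , y ] ]                    ≈⟨ inverseʳ-unique _ _ (trans (sym (assoc _ _ _)) (jacobi a g y)) ⟨
    [ g , [ y , a ] ] + [ y , [ a , g ] ]  ≈⟨ ∙-congˡ [y,[a,g]]≈[[g,a],y] ⟩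
    [ g , [ y , a ] ] + [ [ g , a ] , y ]  ∎
    where
    [y,[a,g]]≈[[g,a],y] : [ y , [ a , g ] ] ≈ [ [ g , a ] , y ]
    [y,[a,g]]≈[[g,a],y] = begin
      [ y , [ a , g ] ]      ≈⟨ bracket-anticomm [ a , g ] y ⟩
      - [ [ a , g ] , y ]    ≈⟨ ⁻¹-cong (bracket-cong (bracket-anticomm g a) refl) ⟩
      - [ - [ g , a ] , y ]  ≈⟨ ⁻¹-cong (bracket-negˡ [ g , a ] y) ⟩
      - - [ [ g , a ] , y ]  ≈⟨ ⁻¹-involutive _ ⟩
      [ [ g , a ] , y ]      ∎

  record IsAdditivelyClosed (S : Subset) : Set (c ⊔ ℓ) where
    field
      ∈-resp-≈   : ∀ {x y} → x ≈ y → S x → S y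
      +-closed   : ∀ {x y} → S x → S y → S (x + y)
      neg-closed : ∀ {x} → S x → S (- x)

  module _ {S : Subset} (S-closed : IsAdditivelyClosed S) where
    open IsAdditivelyClosed S-closed

    nested-bracketˡ-∈ : ∀ {g y a} → S [ g , [ y , a ] ] → S [ [ g , a ] , y ] → S [ [ g , y ] , a ]
    nested-bracketˡ-∈ {g} {y} {a} s₁ s₂ = ∈-resp-≈ (sym (bracket-leibnizʳ g y a)) (+-closed s₁ s₂)

    nested-bracketʳ-∈ : ∀ {g u v} → S [ [ g , u ] , v ] → S [ [ g , v ] , u ] → S [ g , [ u , v ] ]
    nested-bracketʳ-∈ {g} {u} {v} s₁ s₂ = ∈-resp-≈ [[g,u],v]-[[g,v],u]≈[g,[u,v]] (+-closed s₁ (neg-closed s₂))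
      where
      [[g,u],v]-[[g,v],u]≈[g,[u,v]] : [ [ g , u ] , v ] + - [ [ g , v ] , u ] ≈ [ g , [ u , v ] ]
      [[g,u],v]-[[g,v],u]≈[g,[u,v]] = trans (∙-congʳ (bracket-leibnizʳ g u v)) (//-rightDividesʳ _ _)

  Z-closed : ∀ i → IsAdditivelyClosed (Z i)
  Z-closed zero = record
    { ∈-resp-≈   = λ x≈y (lift x≈0) → lift (trans (sym x≈y) x≈0)
    ; +-closed   = λ (lift x≈0) (lift y≈0) → lift (trans (∙-cong x≈0 y≈0) (identityˡ 0#))
    ; neg-closed = λ (lift x≈0) → lift (trans (⁻¹-cong x≈0) ε⁻¹≈ε)
    }
  Z-closed (suc i) = record
    { ∈-resp-≈   = λ x≈y x∈ z _ → ∈-resp-≈ (bracket-cong x≈y refl) (x∈ z tt)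
    ; +-closed   = λ {x} {y} x∈ y∈ z _ → ∈-resp-≈ (sym (bracket-distribʳ x y z)) (+-closed (x∈ z tt) (y∈ z tt))
    ; neg-closed = λ {x} x∈ z _ → ∈-resp-≈ (sym (bracket-negˡ x z)) (neg-closed (x∈ z tt))
    }
    where open IsAdditivelyClosed (Z-closed i)

  -- Commutator k holds of the left-normed commutators [[[x₀ , x₁] , …] , x_k] of weight k + 1.
  Commutator : ℕ → Subset
  Commutator zero    _ = ⊤
  Commutator (suc k) y = ∃[ u ] ∃[ v ] Commutator k u × y ≈ [ u , v ]

  bracket-Z-Commutator : ∀ k j {z y} → Z (k +ℕ suc j) z → Commutator k y → Z j [ z , y ]
  bracket-Z-Commutator zero    j {y = y} z∈ _ = z∈ y tt
  bracket-Z-Commutator (suc k) j {z} z∈ (u , v , u-comm , y≈[u,v]) =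
    IsAdditivelyClosed.∈-resp-≈ (Z-closed j) (bracket-cong refl (sym y≈[u,v]))
      (nested-bracketʳ-∈ (Z-closed j) [[z,u],v]∈ [[z,v],u]∈)
    where
    [[z,u],v]∈ : Z j [ [ z , u ] , v ]
    [[z,u],v]∈ = bracket-Z-Commutator k (suc j) (subst (λ n → Z n z) (≡.sym (+-suc k (suc j))) z∈) u-comm v tt
    [[z,v],u]∈ : Z j [ [ z , v ] , u ]
    [[z,v],u]∈ = bracket-Z-Commutator k j (z∈ v tt) u-comm

  CentModList : Subset → {J : Set c} → (J → Carrier) → List J → Subset
  CentModList S Y F g = All (λ j → S [ g , Y j ]) F

  CentMod-FinSet⇒CentModList : ∀ S A {g} → CentMod S (FinSet (lookup A)) g → CentModList S id A g
  CentMod-FinSet⇒CentModList S A g∈ = All.tabulate λ x∈ → g∈ _ (lift (index x∈ , reflexive (lookup-index x∈)))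

module ChainCondition {c ℓ : Level} (em : ExcludedMiddle (c ⊔ ℓ)) (L : LieRing c ℓ) where
  open LieRing L
  open LieRingTheory L
  open LieRingProperties L

  private
    dne : DoubleNegationElimination (c ⊔ ℓ)
    dne = em⇒dne em

  counterexample : ∀ {A B : Set c} {P : A → Set (c ⊔ ℓ)} {Q : A → B → Set (c ⊔ ℓ)} →
                   ¬ (∀ a → P a → ∀ b → Q a b) → ∃[ b ] ∃[ a ] P a × ¬ Q a b
  counterexample ¬∀ = dne λ ¬∃ → ¬∀ λ a p b → dne λ ¬q → ¬∃ (b , a , p , ¬q)

  DescendingChainCondition : Set (Level.suc (c ⊔ ℓ))
  DescendingChainCondition = ¬ ∃ λ (X : ℕ → Subset) → ∀ n → C (X (suc n)) ⊂ C (X n)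

  centralizer-of-finite-subfamily : DescendingChainCondition → ∀ {J : Set c} (Y : J → Carrier) →
                                    ∃[ F ] ∀ g → CentModList Zero Y F g → ∀ j → Zero [ g , Y j ]
  centralizer-of-finite-subfamily dcc {J} Y = dne λ ¬finite → dcc (descending-chain ¬finite)
    where
    descending-chain : ¬ (∃[ F ] ∀ g → CentModList Zero Y F g → ∀ j → Zero [ g , Y j ]) →
                       ∃ λ (X : ℕ → Subset) → ∀ n → C (X (suc n)) ⊂ C (X n)
    descending-chain ¬finite = X , strict
      where
      escape : ∀ F → ∃[ j ] ∃[ g ] CentModList Zero Y F g × ¬ Zero [ g , Y j ]
      escape F = counterexample λ h → ¬finite (F , h)
      indices : ℕ → List J
      indices zero    = []
      indices (suc n) = proj₁ (escape (indices n)) ∷ indices n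
      X : ℕ → Subset
      X n x = Lift ℓ (x ∈ map Y (indices n))
      strict : ∀ n → C (X (suc n)) ⊂ C (X n)
      strict n =
        let (j , g , g∈ , [g,Yj]≉0) = escape (indices n)
        in (λ h h∈ x (lift x∈) → h∈ x (lift (there x∈)))
         , g , (λ x (lift x∈) → All.lookup (map⁺ g∈) x∈)
         , λ g∈′ → [g,Yj]≉0 (g∈′ (Y j) (lift (here ≡.refl)))

  Determines : ∀ i k {J : Set c} → (J → Carrier) → List J → List Carrier → Set (c ⊔ ℓ)
  Determines i k Y F K =
    ∀ g → CentModList (Z i) Y F g → CentModList (Z (k +ℕ i)) id K g → ∀ j → Z i [ g , Y j ]

  FinitelyDetermined : ℕ → ℕ → Set (Level.suc c ⊔ ℓ)
  FinitelyDetermined i k = ∀ {J : Set c} (Y : J → Carrier) → (∀ j → Commutator k (Y j)) →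
                           ∃[ F ] ∃[ K ] Determines i k Y F K

  FinitelyDetermined-zero : DescendingChainCondition → ∀ {k} → FinitelyDetermined 0 k
  FinitelyDetermined-zero dcc Y _ =
    let (F , F-determines) = centralizer-of-finite-subfamily dcc Y
    in F , [] , λ g g∈ _ → F-determines g g∈

  finite-centralizer⊆Z-suc : ∀ i → FinitelyDetermined i 0 →
                             ∃[ A ] ∀ g → CentModList (Z i) id A g → Z (suc i) g
  finite-centralizer⊆Z-suc i fd =
    let (F , K , FK-determine) = fd id (λ _ → tt)
    in F ++ K , λ g g∈ x _ → FK-determine g (++⁻ˡ F g∈) (++⁻ʳ F g∈) x

  -- Replace Y by the family [Y j , a] (a ∈ A), where centralizing A modulo Z i forces membership
  -- in Z (i + 1). The Leibniz rule trades [g , Y j] ∈ Z (i + 1) for [g , [Y j , a]] ∈ Z i up to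
  -- [[g , a] , Y j], which lies in Z i once [g , a] ∈ Z (k + i + 1).
  FinitelyDetermined-suc : ∀ i k → FinitelyDetermined i 0 → FinitelyDetermined i (suc k) →
                           FinitelyDetermined (suc i) k
  FinitelyDetermined-suc i k fd₀ fd₁ {J} Y Y-comm with finite-centralizer⊆Z-suc i fd₀
  ... | A , A-determines =
    let (F′ , K′ , FK′-determine) = fd₁ Y′ Y′-comm
    in map proj₁ F′ , A ++ K′ , lift-determines FK′-determine
    where
    Y′ : J × ∃ (_∈ A) → Carrier
    Y′ (j , a , _) = [ Y j , a ]

    Y′-comm : ∀ p → Commutator (suc k) (Y′ p)
    Y′-comm (j , a , _) = Y j , a , Y-comm j , refl

    [[g,a],Yj]∈ : ∀ {g} → CentModList (Z (k +ℕ suc i)) id A g → ∀ j {a} → a ∈ A → Z i [ [ g , a ] , Y j ]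
    [[g,a],Yj]∈ A∈ j a∈ = bracket-Z-Commutator k i (All.lookup A∈ a∈) (Y-comm j)

    lift-determines : ∀ {F′ K′} → Determines i (suc k) Y′ F′ K′ →
                      Determines (suc i) k Y (map proj₁ F′) (A ++ K′)
    lift-determines {F′} {K′} FK′-determine g F∈ AK∈ j = A-determines [ g , Y j ] (All.tabulate λ {a} a∈ →
        nested-bracketˡ-∈ (Z-closed i) (FK′-determine g F′∈ K′∈ (j , a , a∈)) ([[g,a],Yj]∈ A∈ j a∈))
      where
      A∈ : CentModList (Z (k +ℕ suc i)) id A g
      A∈ = ++⁻ˡ A AK∈
      K′∈ : CentModList (Z (suc k +ℕ i)) id K′ g
      K′∈ = subst (λ n → CentModList (Z n) id K′ g) (+-suc k i) (++⁻ʳ A AK∈)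
      F′∈ : CentModList (Z i) Y′ F′ g
      F′∈ = All.map (λ { {j , a , a∈} [g,Yj]∈ →
                         nested-bracketʳ-∈ (Z-closed i) ([g,Yj]∈ a tt) ([[g,a],Yj]∈ A∈ j a∈) })
                    (map⁻ F∈)

  finitelyDetermined : DescendingChainCondition → ∀ i k → FinitelyDetermined i k
  finitelyDetermined dcc zero    k = FinitelyDetermined-zero dcc
  finitelyDetermined dcc (suc i) k =
    FinitelyDetermined-suc i k (finitelyDetermined dcc i 0) (finitelyDetermined dcc i (suc k))

mainTheorem7 : ∀ {c ℓ : Level} → ExcludedMiddle (c ⊔ ℓ) → (L : LieRing c ℓ)
                 → LieRingTheory.Mc L → LieRingTheory.Zf L
mainTheorem7 em L (dcc , _) i =
  let (A , A-determines) = finite-centralizer⊆Z-suc i (finitelyDetermined dcc i 0)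
  in length A , lookup A
   , (λ g g∈ x _ → g∈ x tt)
   , λ g g∈ → A-determines g (CentMod-FinSet⇒CentModList (Z i) A g∈)
  where
  open LieRingTheory L using (Z)
  open LieRingProperties L
  open ChainCondition em L
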